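{- Let $\mathcal{A}$ be a nice GFG-tNCW, and let $S,S'$ be safe components of $\mathcal{A}$ with $H(S,S')$. Then for every $p\in S$ there is $p'\in S'$ such that $p\precsim p'$.
   Context: A tNCW is $\mathcal{A}=\langle \Sigma,Q,q_0,\delta,\alpha\rangle$ with finite alphabet $\Sigma$, finite state set $Q$, initial state $q_0$, total transition function $\delta:Q\times\Sigma\to 2^Q\setminus\{\emptyset\}$ with transition relation $\Delta=\{\langle q,\sigma,s\rangle: s\in\delta(q,\sigma)\}$, and $\alpha\subseteq\Delta$ ($\alpha$-transitions; the rest are $\bar\alpha$-transitions); $\delta^{\bar\alpha}(q,\sigma)$ is the set of $\sigma$-successors of $q$ via $\bar\alpha$-transitions. A run on $w=\sigma_1\sigma_2\cdots$ is $r_0r_1\cdots$ with $r_0=q_0$, $r_{i+1}\in\delta(r_i,\sigma_{i+1})$, accepting iff it traverses $\alpha$-transitions only finitely often. $\mathcal{A}^q$ is $\mathcal{A}$ with initial state $q$. $\mathcal{A}$ is GFG if there is $f:\Sigma^*\to Q$ with $f(\epsilon)=q_0$, $\langle f(u),\sigma,f(u\sigma)\rangle\in\Delta$ for all $u,\sigma$, and for every $w\in L(\mathcal{A})$ the run $f(w[1,0]),f(w[1,1]),\dots$ is accepting; a state $q$ is GFG if $\mathcal{A}^q$ is. A run is safe if it uses no $\alpha$-transition; $L_{safe}(\mathcal{A}^q)$ is the set of infinite words with a safe run from $q$. $q\sim s$ iff $L(\mathcal{A}^q)=L(\mathcal{A}^s)$; $q\precsim s$ iff $q\sim s$ and $L_{safe}(\mathcal{A}^q)\subseteq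 L_{safe}(\mathcal{A}^s)$. Safe components are the SCCs of the graph on $Q$ with an edge $q\to q'$ iff some $\bar\alpha$-transition $\langle q,\sigma,q'\rangle$ exists. $\mathcal{A}$ is semantically deterministic if any two $\sigma$-successors of a state are $\sim$-equivalent; safe deterministic if $|\delta^{\bar\alpha}(q,\sigma)|\le1$; normal if a path of $\bar\alpha$-transitions from $q$ to $s$ implies one from $s$ to $q$. A GFG-tNCW is nice if all states are reachable and GFG and it is normal, safe deterministic and semantically deterministic. For safe components $S,S'$, $H(S,S')$ holds iff there are $q\in S$ and $q'\in S'$ with $q\precsim q'$. -}

module Defs where

open import Data.Nat using (ℕ; zero; suc; _≤_)
open import Data.Fin using (Fin)
open import Data.Bool using (Bool; true; false)
open import Data.List using (List; []; _++_; [_])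
open import Data.Product using (Σ; ∃; _×_; _,_)
open import Relation.Binary.PropositionalEquality using (_≡_)

-- The transition relation Δ is given by its characteristic function δ:
-- ⟨q,σ,s⟩ ∈ Δ  iff  δ q σ s ≡ true; totality says δ(q,σ) ≠ ∅.
-- α is the characteristic function of the α-transitions (only its values on
-- transitions in Δ matter, as α ⊆ Δ).
record tNCW (m n : ℕ) : Set where
  field
    q₀    : Fin n
    δ     : Fin n → Fin m → Fin n → Bool
    total : ∀ q σ → ∃ λ s → δ q σ s ≡ true
    α     : Fin n → Fin m → Fin n → Bool

module _ {m n : ℕ} (A : tNCW m n) where
  open tNCW A

  -- infinite words w = σ₁σ₂⋯ are represented as w i = σ_{i+1}
  Word : Set
  Word = ℕ → Fin m

  IsRun : Fin n → Word → (ℕ → Fin n) → Set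
  IsRun q w r = (r 0 ≡ q) × (∀ i → δ (r i) (w i) (r (suc i)) ≡ true)

  Accepting : Word → (ℕ → Fin n) → Set
  Accepting w r = ∃ λ N → ∀ i → N ≤ i → α (r i) (w i) (r (suc i)) ≡ false

  Safe : Word → (ℕ → Fin n) → Set
  Safe w r = ∀ i → α (r i) (w i) (r (suc i)) ≡ false

  Lang : Fin n → Word → Set
  Lang q w = Σ (ℕ → Fin n) λ r → IsRun q w r × Accepting w r

  LangSafe : Fin n → Word → Set
  LangSafe q w = Σ (ℕ → Fin n) λ r → IsRun q w r × Safe w r

  _∼_ : Fin n → Fin n → Set
  q ∼ s = ∀ w → (Lang q w → Lang s w) × (Lang s w → Lang q w)

  _≾_ : Fin n → Fin n → Set
  q ≾ s = (q ∼ s) × (∀ w → LangSafe q w → LangSafe s w)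

  prefix : Word → ℕ → List (Fin m)
  prefix w zero    = []
  prefix w (suc i) = prefix w i ++ [ w i ]

  IsGFGState : Fin n → Set
  IsGFGState q = Σ (List (Fin m) → Fin n) λ f →
      (f [] ≡ q)
    × (∀ u σ → δ (f u) σ (f (u ++ [ σ ])) ≡ true)
    × (∀ w → Lang q w → Accepting w (λ i → f (prefix w i)))

  data Reachable : Fin n → Set where
    reach-init : Reachable q₀
    reach-step : ∀ {q σ s} → Reachable q → δ q σ s ≡ true → Reachable s

  SafeEdge : Fin n → Fin n → Set
  SafeEdge q q' = ∃ λ σ → (δ q σ q' ≡ true) × (α q σ q' ≡ false)

  data SafePath : Fin n → Fin n → Set where
    sp-nil  : ∀ {q} → SafePath q q
    sp-cons : ∀ {q q' s} → SafeEdge q q' → SafePath q' s → SafePath q s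

  IsNormal : Set
  IsNormal = ∀ q s → SafePath q s → SafePath s q

  IsSafeDeterministic : Set
  IsSafeDeterministic = ∀ q σ s s' →
    δ q σ s ≡ true → α q σ s ≡ false →
    δ q σ s' ≡ true → α q σ s' ≡ false → s ≡ s'

  IsSemanticallyDeterministic : Set
  IsSemanticallyDeterministic = ∀ q σ s s' →
    δ q σ s ≡ true → δ q σ s' ≡ true → s ∼ s'

  IsNice : Set
  IsNice = (∀ q → Reachable q) × (∀ q → IsGFGState q)
         × IsNormal × IsSafeDeterministic × IsSemanticallyDeterministic

  SameSCC : Fin n → Fin n → Set
  SameSCC q q' = SafePath q q' × SafePath q' q

  IsSafeComponent : (Fin n → Set) → Set
  IsSafeComponent S = ∃ λ r → ∀ q → (S q → SameSCC r q) × (SameSCC r q → S q)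

  H : (Fin n → Set) → (Fin n → Set) → Set
  H S S' = ∃ λ q → ∃ λ q' → S q × S' q' × (q ≾ q')

-- Walk along a safe path from q to p inside S, starting from q ≾ q'.  If
-- x ≾ x' and x → s is a safe σ-transition with L_safe(A^s) ≠ ∅, then
-- σ·L_safe(A^s) ⊆ L_safe(A^x') forces a safe σ-transition x' → s'; it is unique
-- by safe determinism, whence L_safe(A^s) ⊆ L_safe(A^s'), and semantic
-- determinism gives s ∼ s'.  This yields p' with p ≾ p' on a safe path from q',
-- and by normality p' lies in the safe component S' of q'.  The safe words
-- needed along the way exist because a path q → p of positive length closes a
-- safe cycle (if q = p, take p' = q').
module Submission where

open import Defs
open import Data.Nat using (ℕ; zero; suc; _≤_; s≤s)
open import Data.Nat.Properties using (m≤n⇒m≤1+n)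
open import Data.Fin using (Fin)
open import Data.Bool using (true; false)
open import Data.Product using (∃; _×_; Σ; _,_; proj₁; proj₂)
open import Relation.Binary.PropositionalEquality using (_≡_; refl; subst)

_◂_ : ∀ {a} {X : Set a} → X → (ℕ → X) → ℕ → X
(x ◂ xs) zero    = x
(x ◂ xs) (suc i) = xs i

module _ {m n : ℕ} {A : tNCW m n} where
  open tNCW A

  _++ₚ_ : ∀ {x y z} → SafePath A x y → SafePath A y z → SafePath A x z
  sp-nil      ++ₚ Q = Q
  sp-cons e P ++ₚ Q = sp-cons e (P ++ₚ Q)

  Lang-∷ : ∀ {x y σ w} → δ x σ y ≡ true → Lang A y w → Lang A x (σ ◂ w)
  Lang-∷ {x} d (r , (refl , run) , (N , acc)) =
    (x ◂ r) , (refl , run′) , (suc N , acc′)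
    where
    run′ : ∀ i → δ ((x ◂ r) i) ((_ ◂ _) i) ((x ◂ r) (suc i)) ≡ true
    run′ zero    = d
    run′ (suc i) = run i
    acc′ : ∀ i → suc N ≤ i → α ((x ◂ r) i) ((_ ◂ _) i) ((x ◂ r) (suc i)) ≡ false
    acc′ (suc i) (s≤s N≤i) = acc i N≤i

  Lang-∷⁻¹ : ∀ {x σ w} → Lang A x (σ ◂ w) →
    ∃ λ y → δ x σ y ≡ true × Lang A y w
  Lang-∷⁻¹ (r , (refl , run) , (N , acc)) =
    r 1 , run 0 , (λ i → r (suc i)) , (refl , λ i → run (suc i))
        , (N , λ i N≤i → acc (suc i) (m≤n⇒m≤1+n N≤i))

  LangSafe-∷ : ∀ {x y σ w} → δ x σ y ≡ true → α x σ y ≡ false →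
    LangSafe A y w → LangSafe A x (σ ◂ w)
  LangSafe-∷ {x} d a (r , (refl , run) , safe) = (x ◂ r) , (refl , run′) , safe′
    where
    run′ : ∀ i → δ ((x ◂ r) i) ((_ ◂ _) i) ((x ◂ r) (suc i)) ≡ true
    run′ zero    = d
    run′ (suc i) = run i
    safe′ : ∀ i → α ((x ◂ r) i) ((_ ◂ _) i) ((x ◂ r) (suc i)) ≡ false
    safe′ zero    = a
    safe′ (suc i) = safe i

  LangSafe-∷⁻¹ : ∀ {x σ w} → LangSafe A x (σ ◂ w) →
    ∃ λ y → δ x σ y ≡ true × α x σ y ≡ false × LangSafe A y w
  LangSafe-∷⁻¹ (r , (refl , run) , safe) =
    r 1 , run 0 , safe 0 , (λ i → r (suc i)) , (refl , λ i → run (suc i)) , λ i → safe (suc i)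

  safeWord-backward : ∀ {x y} → SafePath A x y → ∃ (LangSafe A y) → ∃ (LangSafe A x)
  safeWord-backward sp-nil                 W = W
  safeWord-backward (sp-cons (σ , d , a) P) W with safeWord-backward P W
  ... | w , safe = (σ ◂ w) , LangSafe-∷ d a safe

  safeWord-from-closed : (P : Fin n → Set) →
    (∀ {y} → P y → ∃ λ y′ → SafeEdge A y y′ × P y′) →
    ∀ {x} → P x → ∃ (LangSafe A x)
  safeWord-from-closed P next {x} Px = word , state , (refl , λ i → proj₁ (edge i)) , λ i → proj₂ (edge i)
    where
    trace : ℕ → Σ (Fin n) P
    trace zero    = x , Px
    trace (suc i) with next (proj₂ (trace i))
    ... | y′ , _ , Py′ = y′ , Py′
    state : ℕ → Fin n
    state i = proj₁ (trace i)
    word : Word A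
    word i = proj₁ (proj₁ (proj₂ (next (proj₂ (trace i)))))
    edge : ∀ i → δ (state i) (word i) (state (suc i)) ≡ true
                × α (state i) (word i) (state (suc i)) ≡ false
    edge i = proj₂ (proj₁ (proj₂ (next (proj₂ (trace i)))))

  safeWord-on-cycle : ∀ {x z} → SafeEdge A x z → SafePath A z x → ∃ (LangSafe A x)
  safeWord-on-cycle {x} e P = safeWord-from-closed ReturnsTo next (_ , e , P)
    where
    ReturnsTo : Fin n → Set
    ReturnsTo y = ∃ λ y′ → SafeEdge A y y′ × SafePath A y′ x
    next : ∀ {y} → ReturnsTo y → ∃ λ y′ → SafeEdge A y y′ × ReturnsTo y′
    next (y′ , e′ , sp-nil)        = y′ , e′ , _ , e , P
    next (y′ , e′ , sp-cons e″ P′) = y′ , e′ , _ , e″ , P′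

  module _ (semdet : IsSemanticallyDeterministic A) where

    Lang-⊆-succ : ∀ {q q′ σ s s′} → (∀ w → Lang A q w → Lang A q′ w) →
      δ q σ s ≡ true → δ q′ σ s′ ≡ true → ∀ w → Lang A s w → Lang A s′ w
    Lang-⊆-succ {q′ = q′} {σ} {s′ = s′} q⊆q′ d d′ w l
      with Lang-∷⁻¹ (q⊆q′ (σ ◂ w) (Lang-∷ d l))
    ... | y , dy , ly = proj₁ (semdet q′ σ y s′ dy d′ w) ly

    ∼-succ : ∀ {q q′ σ s s′} → _∼_ A q q′ →
      δ q σ s ≡ true → δ q′ σ s′ ≡ true → _∼_ A s s′
    ∼-succ q∼q′ d d′ w =
        Lang-⊆-succ (λ v → proj₁ (q∼q′ v)) d d′ w
      , Lang-⊆-succ (λ v → proj₂ (q∼q′ v)) d′ d w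

    module _ (sdet : IsSafeDeterministic A) where

      ≾-safe-succ : ∀ {x x′ σ s} → _≾_ A x x′ →
        δ x σ s ≡ true → α x σ s ≡ false → ∃ (LangSafe A s) →
        ∃ λ s′ → δ x′ σ s′ ≡ true × α x′ σ s′ ≡ false × _≾_ A s s′
      ≾-safe-succ {x′ = x′} {σ} (x∼x′ , x⊆x′) d a (w₀ , safe₀)
        with LangSafe-∷⁻¹ (x⊆x′ (σ ◂ w₀) (LangSafe-∷ d a safe₀))
      ... | s′ , d′ , a′ , _ = s′ , d′ , a′ , ∼-succ x∼x′ d d′ , s⊆s′
        where
        s⊆s′ : ∀ w → LangSafe A _ w → LangSafe A s′ w
        s⊆s′ w safe with LangSafe-∷⁻¹ (x⊆x′ (σ ◂ w) (LangSafe-∷ d a safe))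
        ... | y , dy , ay , safe′ = subst (λ t → LangSafe A t w) (sdet x′ σ y s′ dy ay d′ a′) safe′

      ≾-along-SafePath : ∀ {x x′ p} → SafePath A x p → ∃ (LangSafe A p) →
        _≾_ A x x′ → ∃ λ p′ → SafePath A x′ p′ × _≾_ A p p′
      ≾-along-SafePath {x′ = x′} sp-nil _ x≾x′ = x′ , sp-nil , x≾x′
      ≾-along-SafePath (sp-cons (σ , d , a) P) W x≾x′
        with ≾-safe-succ x≾x′ d a (safeWord-backward P W)
      ... | s′ , d′ , a′ , s≾s′ with ≾-along-SafePath P W s≾s′
      ... | p′ , P′ , p≾p′ = p′ , sp-cons (σ , d′ , a′) P′ , p≾p′

  SafePath-within : ∀ {S p q} → IsSafeComponent A S → S p → S q → SafePath A p q
  SafePath-within (_ , S⇔) Sp Sq =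
    proj₂ (proj₁ (S⇔ _) Sp) ++ₚ proj₁ (proj₁ (S⇔ _) Sq)

  SafeComponent-closed : IsNormal A → ∀ {S q q′} → IsSafeComponent A S →
    S q → SafePath A q q′ → S q′
  SafeComponent-closed normal (_ , S⇔) Sq Q with proj₁ (S⇔ _) Sq
  ... | r→q , q→r = proj₂ (S⇔ _) (r→q ++ₚ Q , normal _ _ Q ++ₚ q→r)

lemma3p8 : ∀ {m n : ℕ} (A : tNCW m n) → IsNice A →
    (S S' : Fin n → Set) → IsSafeComponent A S → IsSafeComponent A S' →
    H A S S' →
    ∀ p → S p → ∃ λ p' → S' p' × _≾_ A p p'
lemma3p8 A (_ , _ , normal , sdet , semdet) S S' CS CS' (q , q′ , Sq , S'q′ , q≾q′) p Sp =
  transport (SafePath-within CS Sq Sp)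
  where
  p→q : SafePath A p q
  p→q = SafePath-within CS Sp Sq
  transport : SafePath A q p → ∃ λ p′ → S' p′ × _≾_ A p p′
  transport sp-nil = q′ , S'q′ , q≾q′
  transport (sp-cons e P)
    with ≾-along-SafePath semdet sdet (sp-cons e P)
           (safeWord-backward p→q (safeWord-on-cycle e (P ++ₚ p→q))) q≾q′
  ... | p′ , Q , p≾p′ = p′ , SafeComponent-closed normal CS' S'q′ Q , p≾p′
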